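{- For any AC algorithm, the following conditions are equivalent: (i) for all input partitions, each aggregated graph is chordal; (ii) for all input partitions, no aggregated graph has an induced cycle of length $4$; (iii) for all input partitions and every query on vertices $u,v$ made on some aggregated graph $G_t$, the set $N(u)\cap N(v)$ (neighbourhoods taken in $G_t$) separates $u$ and $v$ in $G_t$.
   Context: AC algorithm: on a finite set $S$ with an unknown set partition, it adaptively asks an oracle whether two items are in the same block. Aggregated graphs: $G_0$ is the edgeless graph on $S$; each query concerns two distinct non-adjacent vertices $u,v$ of the current aggregated graph $G_t$; a negative answer adds the edge $uv$; a positive answer merges $u,v$ into one vertex adjacent to all their neighbours, labelled by the union of their labels. The algorithm stops when the aggregated graph is complete. A graph is chordal if all its induced cycles have length $3$. A set $T$ (possibly empty) separates $u,v\notin T$ in a graph $H$ if they lie in distinct components of $H-T$. -}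

module Defs where

open import Data.Nat using (ℕ; zero; suc; _≤_; _≟_)
open import Data.Fin using (Fin; toℕ) renaming (_≟_ to _≟ᶠ_)
open import Data.Bool using (Bool; true; false; _∧_; _∨_; if_then_else_)
open import Data.List using (List; []; _∷_; allFin)
open import Data.Product using (Σ; _×_; _,_; proj₁; proj₂)
open import Data.Sum using (_⊎_)
open import Relation.Nullary using (¬_)
open import Relation.Nullary.Decidable using (⌊_⌋)
open import Relation.Binary.PropositionalEquality using (_≡_; _≢_)
open import Function.Bundles using (_⇔_)

-- The ground set S is Fin n.
-- An aggregated graph is represented on S itself:
--   same a b = true  iff a and b belong to the same (merged) vertex,
--                     i.e. to the same label;
--   adj  a b = true  iff the vertex containing a is adjacent to the
--                     vertex containing b.
-- Vertices of the aggregated graph = classes of `same`; an element of S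
-- is used as a representative of the vertex whose label contains it.

record AGraph (n : ℕ) : Set where
  field
    same : Fin n → Fin n → Bool
    adj  : Fin n → Fin n → Bool
open AGraph public

G₀ : ∀ {n} → AGraph n
G₀ = record { same = λ a b → ⌊ a ≟ᶠ b ⌋ ; adj = λ _ _ → false }

addEdge : ∀ {n} → AGraph n → Fin n → Fin n → AGraph n
addEdge G x y = record
  { same = same G
  ; adj  = λ a b → adj G a b ∨ (same G a x ∧ same G b y) ∨ (same G a y ∧ same G b x)
  }

-- Positive answer: merge the vertices of x and y into one vertex (label
-- = union of the labels) adjacent to all their neighbours.
merge : ∀ {n} → AGraph n → Fin n → Fin n → AGraph n
merge G x y = record
  { same = λ a b → same G a b ∨ (inXY a ∧ inXY b)
  ; adj  = λ a b → if inXY a then (adj G x b ∨ adj G y b)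
                   else (if inXY b then (adj G a x ∨ adj G a y) else adj G a b)
  }
  where
  inXY : _ → Bool
  inXY a = same G a x ∨ same G a y

allᵇ : {A : Set} → (A → Bool) → List A → Bool
allᵇ p [] = true
allᵇ p (a ∷ as) = p a ∧ allᵇ p as

completeᵇ : ∀ {n} → AGraph n → Bool
completeᵇ {n} G = allᵇ (λ a → allᵇ (λ b → same G a b ∨ adj G a b) (allFin n)) (allFin n)

Same : ∀ {n} → AGraph n → Fin n → Fin n → Set
Same G a b = same G a b ≡ true

Adj : ∀ {n} → AGraph n → Fin n → Fin n → Set
Adj G a b = adj G a b ≡ true

Complete : ∀ {n} → AGraph n → Set
Complete G = completeᵇ G ≡ true

-- A (deterministic, adaptive) strategy chooses the next query from the
-- history of the oracle's answers (most recent first); the query is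
-- given by one representative element of each of the two vertices.
Strategy : ℕ → Set
Strategy n = List Bool → Fin n × Fin n

-- A partition of S is given by a block-labelling β : Fin n → ℕ
-- (x, y in the same block iff β x ≡ β y); every partition arises so.
Partition : ℕ → Set
Partition n = Fin n → ℕ

oracle : ∀ {n} → Partition n → Fin n → Fin n → Bool
oracle β x y = ⌊ β x ≟ β y ⌋

-- State after t steps: (history of answers , aggregated graph G_t).
-- Once the graph is complete the algorithm has stopped and the state
-- no longer changes.
run : ∀ {n} → Strategy n → Partition n → ℕ → List Bool × AGraph n
run A β zero = [] , G₀
run A β (suc t) with run A β t
... | h , G = if completeᵇ G then (h , G)
              else (let q = A h ; x = proj₁ q ; y = proj₂ q ; b = oracle β x y
                    in (b ∷ h) , (if b then merge G x y else addEdge G x y))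

graphAt : ∀ {n} → Strategy n → Partition n → ℕ → AGraph n
graphAt A β t = proj₂ (run A β t)

queryAt : ∀ {n} → Strategy n → Partition n → ℕ → Fin n × Fin n
queryAt A β t = A (proj₁ (run A β t))

record ACAlgorithm (n : ℕ) : Set where
  field
    strategy : Strategy n
    valid    : ∀ (β : Partition n) (t : ℕ) → ¬ Complete (graphAt strategy β t) →
               ¬ Same (graphAt strategy β t) (proj₁ (queryAt strategy β t)) (proj₂ (queryAt strategy β t)) ×
               ¬ Adj  (graphAt strategy β t) (proj₁ (queryAt strategy β t)) (proj₂ (queryAt strategy β t))
open ACAlgorithm public

CycNext : ∀ {k} → Fin k → Fin k → Set
CycNext {k} i j = suc (toℕ i) ≡ toℕ j ⊎ (suc (toℕ i) ≡ k × toℕ j ≡ 0)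

record InducedCycle {n} (G : AGraph n) (k : ℕ) (c : Fin k → Fin n) : Set where
  field
    length≥3 : 3 ≤ k
    distinct : ∀ i j → i ≢ j → ¬ Same G (c i) (c j)
    adjacency : ∀ i j → Adj G (c i) (c j) ⇔ (CycNext i j ⊎ CycNext j i)

Chordal : ∀ {n} → AGraph n → Set
Chordal {n} G = ∀ (k : ℕ) (c : Fin k → Fin n) → InducedCycle G k c → k ≡ 3

HasInducedC4 : ∀ {n} → AGraph n → Set
HasInducedC4 {n} G = Σ (Fin 4 → Fin n) (InducedCycle G 4)

data Walk {n} (G : AGraph n) (T : Fin n → Set) : Fin n → Fin n → Set where
  nil  : ∀ {a} → ¬ T a → Walk G T a a
  step : ∀ {a b c} → ¬ T a → Adj G a b → Walk G T b c → Walk G T a c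

Separates : ∀ {n} (G : AGraph n) (T : Fin n → Set) → Fin n → Fin n → Set
Separates G T u v = ¬ T u × ¬ T v × ¬ Walk G T u v

CommonNbhd : ∀ {n} → AGraph n → Fin n → Fin n → Fin n → Set
CommonNbhd G u v w = Adj G w u × Adj G w v

CondChordal : ∀ {n} → ACAlgorithm n → Set
CondChordal {n} A = ∀ (β : Partition n) (t : ℕ) → Chordal (graphAt (strategy A) β t)

CondNoC4 : ∀ {n} → ACAlgorithm n → Set
CondNoC4 {n} A = ∀ (β : Partition n) (t : ℕ) → ¬ HasInducedC4 (graphAt (strategy A) β t)

CondSeparation : ∀ {n} → ACAlgorithm n → Set
CondSeparation {n} A = ∀ (β : Partition n) (t : ℕ) →
  ¬ Complete (graphAt (strategy A) β t) →
  let G = graphAt (strategy A) β t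
      u = proj₁ (queryAt (strategy A) β t)
      v = proj₂ (queryAt (strategy A) β t)
  in Separates G (CommonNbhd G u v) u v

-- Freeze the input at time t: answer every later query according to the
-- vertices of G_t. The run is unchanged up to t and afterwards all answers are
-- negative, so only edges are added. An edge added to a graph with a hole of
-- length ≥ 5 leaves a hole (it cuts the hole along a chord), and complete graphs
-- have none, so a long hole in G_t eventually turns into an induced 4-cycle;
-- this gives (ii) ⇒ (i). If the query u, v at time t is not separated by
-- N(u) ∩ N(v), a shortest walk from u to v avoiding it is an induced path of
-- length ≥ 3, closed to a hole by the negative answer; this gives (ii) ⇒ (iii).
-- Conversely, under (iii) an induced 4-cycle in G_{t+1} but not in G_t must pass
-- through the new edge uv or the merged vertex, and then yields either a walk
-- from u to v avoiding N(u) ∩ N(v) or an induced 4-cycle already in G_t.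
module Submission where

open import Data.Bool using (Bool; true; false; _∧_; _∨_; if_then_else_)
open import Data.Bool.Properties using (¬-not; not-¬; ∨-identityʳ)
open import Data.Empty using (⊥; ⊥-elim)
open import Data.Fin using (Fin; _≟_; toℕ) renaming (zero to fzero; suc to fsuc)
open import Data.Fin.Properties using (toℕ-injective; toℕ<n)
open import Data.List using (List; []; _∷_; allFin)
open import Data.List.Membership.Propositional using (_∈_)
open import Data.List.Membership.Propositional.Properties using (∈-allFin)
open import Data.List.Relation.Unary.Any using (here; there)
open import Data.Nat
  using (ℕ; zero; suc; _+_; _∸_; _≤_; _<_; _≤?_; _<?_; z≤n; s≤s; z<s; s≤s⁻¹; _≤′_; ≤′-refl; ≤′-step)
open import Data.Nat.Induction using (<-wellFounded)
open import Data.Nat.Properties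
  using ( suc-injective; 0≢1+n; 1+n≢0; n≮0; ≤-refl; ≤-trans; <-trans; <-≤-trans; ≤-<-trans; <-irrefl
        ; <-cmp; <⇒≤; ≤⇒≤′; ≤∧≢⇒<; n≤1+n; n<1+n; m≤n⇒m≤1+n; m≤n⇒m<n∨m≡n
        ; +-mono-≤; +-mono-<-≤; +-mono-≤-<; +-monoˡ-<; +-monoˡ-≤; +-cancelʳ-≤; m<m+n
        ; m+[n∸m]≡n; m∸n+n≡m; m∸n≤m; m<n⇒0<n∸m )
  renaming (_≟_ to _≟ℕ_)
open import Data.Product using (Σ; _×_; _,_; proj₁; proj₂)
open import Data.Sum using (_⊎_; inj₁; inj₂; [_,_]′; swap; map₂)
open import Function using (id; _∘_)
open import Function.Bundles using (_⇔_; Equivalence; mk⇔)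
open import Induction.WellFounded using (Acc; acc)
open import Relation.Binary using (tri<; tri≈; tri>)
open import Relation.Binary.PropositionalEquality
open import Relation.Nullary using (¬_; Dec; yes; no)
open import Relation.Nullary.Decidable using (⌊_⌋; isYes≗does; dec-true)

open import Defs

∨-trueˡ : ∀ {a b} → a ≡ true → a ∨ b ≡ true
∨-trueˡ refl = refl

∨-trueʳ : ∀ {a b} → b ≡ true → a ∨ b ≡ true
∨-trueʳ {true}  _ = refl
∨-trueʳ {false} e = e

∨-true⁻ : ∀ {a b} → a ∨ b ≡ true → a ≡ true ⊎ b ≡ true
∨-true⁻ {true}  _ = inj₁ refl
∨-true⁻ {false} e = inj₂ e

∨-map-true : ∀ {a b c d} → (a ≡ true → c ≡ true) → (b ≡ true → d ≡ true) →
             a ∨ b ≡ true → c ∨ d ≡ true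
∨-map-true {a} f g e with ∨-true⁻ {a} e
... | inj₁ p = ∨-trueˡ (f p)
... | inj₂ p = ∨-trueʳ (g p)

∨-false : ∀ {a b} → a ≡ false → b ≡ false → a ∨ b ≡ false
∨-false refl e = e

∨-false⁻ : ∀ {a b} → a ∨ b ≡ false → a ≡ false × b ≡ false
∨-false⁻ {false} e = refl , e

∧-true : ∀ {a b} → a ≡ true → b ≡ true → a ∧ b ≡ true
∧-true refl e = e

∧-true⁻ : ∀ {a b} → a ∧ b ≡ true → a ≡ true × b ≡ true
∧-true⁻ {true} e = refl , e

≡true⇒≢false : ∀ {a} → a ≡ true → a ≢ false
≡true⇒≢false refl ()

true-iff⇒≡ : ∀ {a b} → (a ≡ true → b ≡ true) → (b ≡ true → a ≡ true) → a ≡ b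
true-iff⇒≡ {true}  {true}  _ _ = refl
true-iff⇒≡ {true}  {false} f _ = sym (f refl)
true-iff⇒≡ {false} {true}  _ g = g refl
true-iff⇒≡ {false} {false} _ _ = refl

bool-cases : ∀ {C : Set} b → (b ≡ true → C) → (b ≡ false → C) → C
bool-cases true  t _ = t refl
bool-cases false _ f = f refl

isYes-true : ∀ {P : Set} (p? : Dec P) → P → ⌊ p? ⌋ ≡ true
isYes-true p? p = trans (isYes≗does p?) (dec-true p? p)

isYes-true⁻ : ∀ {P : Set} (p? : Dec P) → ⌊ p? ⌋ ≡ true → P
isYes-true⁻ (yes p) _ = p

record IsAggregated {n} (G : AGraph n) : Set where
  field
    same-refl  : ∀ a → same G a a ≡ true
    same-sym   : ∀ {a b} → same G a b ≡ true → same G b a ≡ true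
    same-trans : ∀ {a b c} → same G a b ≡ true → same G b c ≡ true → same G a c ≡ true
    adj-sym    : ∀ {a b} → adj G a b ≡ true → adj G b a ≡ true
    adj-respˡ  : ∀ {a a′ b} → same G a a′ ≡ true → adj G a b ≡ true → adj G a′ b ≡ true
    adj-irrefl : ∀ {a b} → adj G a b ≡ true → same G a b ≡ true → ⊥

  adj-respʳ : ∀ {a b b′} → same G b b′ ≡ true → adj G a b ≡ true → adj G a b′ ≡ true
  adj-respʳ e h = adj-sym (adj-respˡ e (adj-sym h))

  adj-resp : ∀ {a a′ b b′} → same G a a′ ≡ true → same G b b′ ≡ true →
             adj G a b ≡ true → adj G a′ b′ ≡ true
  adj-resp e₁ e₂ h = adj-respʳ e₂ (adj-respˡ e₁ h)

  same-symᶠ : ∀ {a b} → same G a b ≡ false → same G b a ≡ false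
  same-symᶠ e = ¬-not (λ h → ≡true⇒≢false (same-sym h) e)

  adj-symᶠ : ∀ {a b} → adj G a b ≡ false → adj G b a ≡ false
  adj-symᶠ e = ¬-not (λ h → ≡true⇒≢false (adj-sym h) e)

  adj⇒¬same : ∀ {a b} → adj G a b ≡ true → same G a b ≡ false
  adj⇒¬same h = ¬-not (adj-irrefl h)

  adj-respᶠ : ∀ {a a′ b b′} → same G a a′ ≡ true → same G b b′ ≡ true →
              adj G a′ b′ ≡ false → adj G a b ≡ false
  adj-respᶠ e₁ e₂ f = ¬-not (λ h → ≡true⇒≢false (adj-resp e₁ e₂ h) f)

  same-respʳᶠ : ∀ {a b b′} → same G b b′ ≡ true → same G a b ≡ false → same G a b′ ≡ false
  same-respʳᶠ e f = ¬-not (λ h → ≡true⇒≢false (same-trans h (same-sym e)) f)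

G₀-isAggregated : ∀ {n} → IsAggregated (G₀ {n})
G₀-isAggregated = record
  { same-refl  = λ a → isYes-true (a ≟ a) refl
  ; same-sym   = λ h → isYes-true _ (sym (isYes-true⁻ _ h))
  ; same-trans = λ h₁ h₂ → isYes-true _ (trans (isYes-true⁻ _ h₁) (isYes-true⁻ _ h₂))
  ; adj-sym = λ () ; adj-respˡ = λ _ () ; adj-irrefl = λ () }

module _ {n} (G : AGraph n) (x y : Fin n) where

  addEdge-adj⁻ : ∀ {a b} → adj (addEdge G x y) a b ≡ true →
                 adj G a b ≡ true ⊎ (same G a x ≡ true × same G b y ≡ true)
                                  ⊎ (same G a y ≡ true × same G b x ≡ true)
  addEdge-adj⁻ {a} {b} h with ∨-true⁻ {adj G a b} h
  ... | inj₁ p = inj₁ p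
  ... | inj₂ q with ∨-true⁻ {same G a x ∧ same G b y} q
  ...   | inj₁ r = inj₂ (inj₁ (∧-true⁻ r))
  ...   | inj₂ r = inj₂ (inj₂ (∧-true⁻ {same G a y} r))

  addEdge-keeps-adj : ∀ {a b} → adj G a b ≡ true → adj (addEdge G x y) a b ≡ true
  addEdge-keeps-adj = ∨-trueˡ

  addEdge-adj-xy : ∀ {a b} → same G a x ≡ true → same G b y ≡ true → adj (addEdge G x y) a b ≡ true
  addEdge-adj-xy {a} e₁ e₂ = ∨-trueʳ {adj G a _} (∨-trueˡ (∧-true e₁ e₂))

  addEdge-adj-yx : ∀ {a b} → same G a y ≡ true → same G b x ≡ true → adj (addEdge G x y) a b ≡ true
  addEdge-adj-yx {a} {b} e₁ e₂ =
    ∨-trueʳ {adj G a b} (∨-trueʳ {same G a x ∧ same G b y} (∧-true e₁ e₂))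

addEdge-isAggregated : ∀ {n} {G : AGraph n} {x y} → IsAggregated G → same G x y ≡ false →
                       IsAggregated (addEdge G x y)
addEdge-isAggregated {G = G} {x} {y} agg x≉y = record
  { same-refl = same-refl ; same-sym = same-sym ; same-trans = same-trans
  ; adj-sym = adj-sym′ ; adj-respˡ = adj-respˡ′ ; adj-irrefl = adj-irrefl′ }
  where
  open IsAggregated agg
  adj-sym′ : ∀ {a b} → adj (addEdge G x y) a b ≡ true → adj (addEdge G x y) b a ≡ true
  adj-sym′ h with addEdge-adj⁻ G x y h
  ... | inj₁ p             = addEdge-keeps-adj G x y (adj-sym p)
  ... | inj₂ (inj₁ (p , q)) = addEdge-adj-yx G x y q p
  ... | inj₂ (inj₂ (p , q)) = addEdge-adj-xy G x y q p
  adj-respˡ′ : ∀ {a a′ b} → same G a a′ ≡ true → adj (addEdge G x y) a b ≡ true →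
               adj (addEdge G x y) a′ b ≡ true
  adj-respˡ′ e h with addEdge-adj⁻ G x y h
  ... | inj₁ p             = addEdge-keeps-adj G x y (adj-respˡ e p)
  ... | inj₂ (inj₁ (p , q)) = addEdge-adj-xy G x y (same-trans (same-sym e) p) q
  ... | inj₂ (inj₂ (p , q)) = addEdge-adj-yx G x y (same-trans (same-sym e) p) q
  adj-irrefl′ : ∀ {a b} → adj (addEdge G x y) a b ≡ true → same G a b ≡ true → ⊥
  adj-irrefl′ h s with addEdge-adj⁻ G x y h
  ... | inj₁ p             = adj-irrefl p s
  ... | inj₂ (inj₁ (p , q)) = ≡true⇒≢false (same-trans (same-sym p) (same-trans s q)) x≉y
  ... | inj₂ (inj₂ (p , q)) = ≡true⇒≢false (same-sym (same-trans (same-sym p) (same-trans s q))) x≉y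

inMerged : ∀ {n} → AGraph n → Fin n → Fin n → Fin n → Bool
inMerged G x y a = same G a x ∨ same G a y

module _ {n} (G : AGraph n) (x y : Fin n) where
  private
    I = inMerged G x y

  merge-adj-from : ∀ {a b} → I a ≡ true → adj (merge G x y) a b ≡ adj G x b ∨ adj G y b
  merge-adj-from {a} {b} e =
    cong (λ i → if i then adj G x b ∨ adj G y b
                else (if I b then adj G a x ∨ adj G a y else adj G a b)) e

  merge-adj-outside : ∀ {a b} → I a ≡ false → I b ≡ false → adj (merge G x y) a b ≡ adj G a b
  merge-adj-outside {a} {b} ea eb rewrite ea | eb = refl

  merge-same-outside : ∀ {a b} → I a ≡ false → same (merge G x y) a b ≡ same G a b
  merge-same-outside {a} {b} ea rewrite ea = ∨-identityʳ (same G a b)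

module Merge {n} {G : AGraph n} {x y : Fin n} (agg : IsAggregated G) (x≁y : adj G x y ≡ false) where
  open IsAggregated agg
  private
    G′ = merge G x y
    I = inMerged G x y

  inMerged-resp : ∀ {a b} → same G a b ≡ true → I a ≡ true → I b ≡ true
  inMerged-resp e = ∨-map-true (same-trans (same-sym e)) (same-trans (same-sym e))

  inMerged-x : I x ≡ true
  inMerged-x = ∨-trueˡ (same-refl x)

  inMerged-y : I y ≡ true
  inMerged-y = ∨-trueʳ {same G y x} (same-refl y)

  merged-nonadj : ∀ {b} → I b ≡ true → adj G x b ∨ adj G y b ≡ false
  merged-nonadj {b} h with ∨-true⁻ {same G b x} h
  ... | inj₁ p = ∨-false (¬-not (λ q → adj-irrefl (adj-respʳ p q) (same-refl x)))
                         (¬-not (λ q → ≡true⇒≢false (adj-sym (adj-respʳ p q)) x≁y))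
  ... | inj₂ p = ∨-false (¬-not (λ q → ≡true⇒≢false (adj-respʳ p q) x≁y))
                         (¬-not (λ q → adj-irrefl (adj-respʳ p q) (same-refl y)))

  merge-same⁻ : ∀ {a b} → same G′ a b ≡ true → same G a b ≡ true ⊎ (I a ≡ true × I b ≡ true)
  merge-same⁻ {a} h with ∨-true⁻ {same G a _} h
  ... | inj₁ p = inj₁ p
  ... | inj₂ p = inj₂ (∧-true⁻ p)

  merge-same⇒inMerged-≡ : ∀ {a b} → same G′ a b ≡ true → I a ≡ I b
  merge-same⇒inMerged-≡ h with merge-same⁻ h
  ... | inj₁ s       = true-iff⇒≡ (inMerged-resp s) (inMerged-resp (same-sym s))
  ... | inj₂ (p , q) = trans p (sym q)

  merge-keeps-same : ∀ {a b} → same G a b ≡ true → same G′ a b ≡ true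
  merge-keeps-same = ∨-trueˡ

  merge-same-merged : ∀ {a b} → I a ≡ true → I b ≡ true → same G′ a b ≡ true
  merge-same-merged {a} {b} p q = ∨-trueʳ {same G a b} (∧-true p q)

  merge-keeps-adj : ∀ {a b} → adj G a b ≡ true → adj G′ a b ≡ true
  merge-keeps-adj {a} {b} h with I a in ea | I b in eb
  ... | true  | _     = ∨-map-true (λ p → adj-respˡ p h) (λ p → adj-respˡ p h) ea
  ... | false | true  = ∨-map-true (λ p → adj-respʳ p h) (λ p → adj-respʳ p h) eb
  ... | false | false = h

  merge-isAggregated : IsAggregated G′
  merge-isAggregated = record
    { same-refl = λ a → ∨-trueˡ (same-refl a) ; same-sym = same-sym′ ; same-trans = same-trans′
    ; adj-sym = adj-sym′ ; adj-respˡ = adj-respˡ′ ; adj-irrefl = adj-irrefl′ }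
    where
    same-sym′ : ∀ {a b} → same G′ a b ≡ true → same G′ b a ≡ true
    same-sym′ h with merge-same⁻ h
    ... | inj₁ p       = merge-keeps-same (same-sym p)
    ... | inj₂ (p , q) = merge-same-merged q p
    same-trans′ : ∀ {a b c} → same G′ a b ≡ true → same G′ b c ≡ true → same G′ a c ≡ true
    same-trans′ h₁ h₂ with merge-same⁻ h₁ | merge-same⁻ h₂
    ... | inj₁ p        | inj₁ q        = merge-keeps-same (same-trans p q)
    ... | inj₁ p        | inj₂ (q , q′) = merge-same-merged (inMerged-resp (same-sym p) q) q′
    ... | inj₂ (p , p′) | inj₁ q        = merge-same-merged p (inMerged-resp q p′)
    ... | inj₂ (p , _)  | inj₂ (_ , q′) = merge-same-merged p q′
    adj-sym′ : ∀ {a b} → adj G′ a b ≡ true → adj G′ b a ≡ true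
    adj-sym′ {a} {b} h with I a in ea | I b in eb
    ... | true  | true  = ⊥-elim (≡true⇒≢false h (merged-nonadj eb))
    ... | true  | false = ∨-map-true adj-sym adj-sym h
    ... | false | true  = ∨-map-true adj-sym adj-sym h
    ... | false | false = adj-sym h
    adj-respˡ′ : ∀ {a a′ b} → same G′ a a′ ≡ true → adj G′ a b ≡ true → adj G′ a′ b ≡ true
    adj-respˡ′ {a} {a′} {b} e h
      with I a in ea | I a′ in ea′ | I b in eb | merge-same⇒inMerged-≡ e | merge-same⁻ e
    ... | true  | true  | _     | _  | _           = h
    ... | true  | false | _     | () | _
    ... | false | true  | _     | () | _
    ... | false | false | _     | _  | inj₂ (() , _)
    ... | false | false | true  | _  | inj₁ s      = ∨-map-true (adj-respˡ s) (adj-respˡ s) h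
    ... | false | false | false | _  | inj₁ s      = adj-respˡ s h
    adj-irrefl′ : ∀ {a b} → adj G′ a b ≡ true → same G′ a b ≡ true → ⊥
    adj-irrefl′ {a} {b} h e with I a in ea | I b in eb | merge-same⇒inMerged-≡ e | merge-same⁻ e
    ... | true  | true  | _  | _           = ≡true⇒≢false h (merged-nonadj eb)
    ... | true  | false | () | _
    ... | false | true  | () | _
    ... | false | false | _  | inj₂ (() , _)
    ... | false | false | _  | inj₁ s      = adj-irrefl h s

sumOver : ∀ {X : Set} → List X → (X → ℕ) → ℕ
sumOver []       f = 0
sumOver (a ∷ as) f = f a + sumOver as f

sumOver-mono : ∀ {X : Set} (as : List X) {f g : X → ℕ} → (∀ a → f a ≤ g a) →
               sumOver as f ≤ sumOver as g
sumOver-mono []       _   = z≤n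
sumOver-mono (a ∷ as) f≤g = +-mono-≤ (f≤g a) (sumOver-mono as f≤g)

sumOver-strict : ∀ {X : Set} (as : List X) {f g : X → ℕ} {c} → (∀ a → f a ≤ g a) →
                 c ∈ as → f c < g c → sumOver as f < sumOver as g
sumOver-strict (a ∷ as) f≤g (here refl) lt = +-mono-<-≤ lt (sumOver-mono as f≤g)
sumOver-strict (a ∷ as) f≤g (there c∈)  lt = +-mono-≤-< (f≤g a) (sumOver-strict as f≤g c∈ lt)

nonAdjacentPairs : ∀ {n} → AGraph n → ℕ
nonAdjacentPairs {n} G =
  sumOver (allFin n) λ a → sumOver (allFin n) λ b → if adj G a b then 0 else 1

nonAdjacentPairs-< : ∀ {n} {G G′ : AGraph n} {x y} →
                     (∀ {a b} → adj G a b ≡ true → adj G′ a b ≡ true) →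
                     adj G x y ≡ false → adj G′ x y ≡ true →
                     nonAdjacentPairs G′ < nonAdjacentPairs G
nonAdjacentPairs-< {n} {G} {G′} {x} {y} G⊆G′ x≁y x∼′y =
  sumOver-strict (allFin n) (λ a → sumOver-mono (allFin n) (indicator-mono a)) (∈-allFin x)
    (sumOver-strict (allFin n) (indicator-mono x) (∈-allFin y) (indicator-< x≁y x∼′y))
  where
  indicator-mono : ∀ a b → (if adj G′ a b then 0 else 1) ≤ (if adj G a b then 0 else 1)
  indicator-mono a b with adj G a b in e | adj G′ a b in e′
  ... | true  | false = ⊥-elim (≡true⇒≢false (G⊆G′ e) e′)
  ... | true  | true  = z≤n
  ... | false | true  = z≤n
  ... | false | false = ≤-refl
  indicator-< : ∀ {c c′ : Bool} → c ≡ false → c′ ≡ true → (if c′ then 0 else 1) < (if c then 0 else 1)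
  indicator-< refl refl = s≤s z≤n

-- f 0, f 1, …, f m is an induced cycle of length m + 1 ≥ 4.
record Hole {n} (G : AGraph n) (m : ℕ) (f : ℕ → Fin n) : Set where
  field
    size      : 3 ≤ m
    distinct  : ∀ {i j} → i < j → j ≤ m → same G (f i) (f j) ≡ false
    edge      : ∀ {i} → i < m → adj G (f i) (f (suc i)) ≡ true
    closing   : adj G (f 0) (f m) ≡ true
    chordless : ∀ {i j} → suc i < j → j ≤ m → 0 < i ⊎ j < m → adj G (f i) (f j) ≡ false

Chordless : ∀ {n} → AGraph n → ℕ → (ℕ → Fin n) → Set
Chordless G L w = ∀ {i j} → suc i < j → j ≤ L → adj G (w i) (w j) ≡ false

HasHole : ∀ {n} → AGraph n → Set
HasHole {n} G = Σ ℕ λ m → Σ (ℕ → Fin n) λ f → Hole G m f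

record AddsEdge {n} (G G′ : AGraph n) (u v : Fin n) : Set where
  field
    same-≡   : ∀ a b → same G′ a b ≡ same G a b
    adj-kept : ∀ {a b} → adj G a b ≡ true → adj G′ a b ≡ true
    adj-new  : ∀ {a b} → adj G′ a b ≡ true →
               adj G a b ≡ true ⊎ (same G a u ≡ true × same G b v ≡ true)
                                ⊎ (same G a v ≡ true × same G b u ≡ true)
    adj-uv   : adj G′ u v ≡ true
    adj-vu   : adj G′ v u ≡ true

AddsEdge-sym : ∀ {n} {G G′ : AGraph n} {u v} → AddsEdge G G′ u v → AddsEdge G G′ v u
AddsEdge-sym e = record
  { same-≡ = same-≡ ; adj-kept = adj-kept ; adj-new = map₂ swap ∘ adj-new ; adj-uv = adj-vu ; adj-vu = adj-uv }
  where open AddsEdge e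

AddsEdge-cong : ∀ {n} {G G′ : AGraph n} {u v u′ v′} → u ≡ u′ → v ≡ v′ →
                AddsEdge G G′ u v → AddsEdge G G′ u′ v′
AddsEdge-cong refl refl e = e

addEdge-AddsEdge : ∀ {n} {G : AGraph n} {x y u v} → IsAggregated G →
                   same G u x ≡ true → same G v y ≡ true → AddsEdge G (addEdge G x y) u v
addEdge-AddsEdge {G = G} {x} {y} {u} {v} agg u≈x v≈y = record
  { same-≡ = λ _ _ → refl ; adj-kept = addEdge-keeps-adj G x y ; adj-new = adj-new
  ; adj-uv = addEdge-adj-xy G x y u≈x v≈y ; adj-vu = addEdge-adj-yx G x y v≈y u≈x }
  where
  open IsAggregated agg
  adj-new : ∀ {a b} → adj (addEdge G x y) a b ≡ true →
            adj G a b ≡ true ⊎ (same G a u ≡ true × same G b v ≡ true)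
                             ⊎ (same G a v ≡ true × same G b u ≡ true)
  adj-new h with addEdge-adj⁻ G x y h
  ... | inj₁ p             = inj₁ p
  ... | inj₂ (inj₁ (p , q)) = inj₂ (inj₁ (same-trans p (same-sym u≈x) , same-trans q (same-sym v≈y)))
  ... | inj₂ (inj₂ (p , q)) = inj₂ (inj₂ (same-trans p (same-sym v≈y) , same-trans q (same-sym u≈x)))

bounded-search : {Q R : ℕ → Set} → (∀ p → Q p ⊎ R p) → ∀ m →
                 Σ ℕ (λ p → p < m × Q p) ⊎ (∀ p → p < m → R p)
bounded-search dec zero = inj₂ λ _ ()
bounded-search dec (suc m) with bounded-search dec m | dec m
... | inj₁ (p , p<m , q) | _     = inj₁ (p , m≤n⇒m≤1+n p<m , q)
... | inj₂ _             | inj₁ q = inj₁ (m , ≤-refl , q)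
... | inj₂ below         | inj₂ r =
  inj₂ λ p p<1+m → [ below p , (λ { refl → r }) ]′ (m≤n⇒m<n∨m≡n (s≤s⁻¹ p<1+m))

module Holes {n} {G : AGraph n} (agg : IsAggregated G) where
  open IsAggregated agg

  rotate : ℕ → (ℕ → Fin n) → ℕ → Fin n
  rotate m f i with i ≟ℕ m
  ... | yes _ = f 0
  ... | no  _ = f (suc i)

  rotate-< : ∀ {m f i} → i < m → rotate m f i ≡ f (suc i)
  rotate-< {m} {f} {i} i<m with i ≟ℕ m
  ... | yes refl = ⊥-elim (<-irrefl refl i<m)
  ... | no  _    = refl

  rotate-last : ∀ {m f} → rotate m f m ≡ f 0
  rotate-last {m} with m ≟ℕ m
  ... | yes _   = refl
  ... | no  m≢m = ⊥-elim (m≢m refl)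

  hole-rotate : ∀ {m f} → Hole G m f → Hole G m (rotate m f)
  hole-rotate {m} {f} H = record
    { size = size ; distinct = distinct′ ; edge = edge′ ; closing = closing′ ; chordless = chordless′ }
    where
    open Hole H
    distinct′ : ∀ {i j} → i < j → j ≤ m → same G (rotate m f i) (rotate m f j) ≡ false
    distinct′ {i} {j} i<j j≤m with m≤n⇒m<n∨m≡n j≤m
    ... | inj₁ j<m rewrite rotate-< {m} {f} (<-trans i<j j<m) | rotate-< {m} {f} j<m = distinct (s≤s i<j) j<m
    ... | inj₂ refl rewrite rotate-< {m} {f} i<j | rotate-last {m} {f} = same-symᶠ (distinct z<s i<j)
    edge′ : ∀ {i} → i < m → adj G (rotate m f i) (rotate m f (suc i)) ≡ true
    edge′ {i} i<m rewrite rotate-< {m} {f} i<m with m≤n⇒m<n∨m≡n i<m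
    ... | inj₁ 1+i<m rewrite rotate-< {m} {f} 1+i<m = edge 1+i<m
    ... | inj₂ refl rewrite rotate-last {suc i} {f} = adj-sym closing
    closing′ : adj G (rotate m f 0) (rotate m f m) ≡ true
    closing′ rewrite rotate-< {m} {f} (<-≤-trans z<s size) | rotate-last {m} {f} =
      adj-sym (edge (<-≤-trans z<s size))
    chordless′ : ∀ {i j} → suc i < j → j ≤ m → 0 < i ⊎ j < m →
                 adj G (rotate m f i) (rotate m f j) ≡ false
    chordless′ {i} {j} 1+i<j j≤m inner with m≤n⇒m<n∨m≡n j≤m
    ... | inj₁ j<m rewrite rotate-< {m} {f} (<-trans (<-trans (n<1+n i) 1+i<j) j<m) | rotate-< {m} {f} j<m =
      chordless (s≤s 1+i<j) j<m (inj₁ z<s)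
    ... | inj₂ refl rewrite rotate-< {m} {f} (<-trans (n<1+n i) 1+i<j) | rotate-last {j} {f} with inner
    ...   | inj₁ 0<i = adj-symᶠ (chordless (s≤s 0<i) (<⇒≤ 1+i<j) (inj₂ 1+i<j))
    ...   | inj₂ j<j = ⊥-elim (<-irrefl refl j<j)

  path-close : ∀ {L w G′} → 3 ≤ L →
               (∀ {i j} → i < j → j ≤ L → same G (w i) (w j) ≡ false) →
               (∀ {i} → i < L → adj G (w i) (w (suc i)) ≡ true) → Chordless G L w →
               AddsEdge G G′ (w 0) (w L) → Hole G′ L w
  path-close {L} {w} {G′} 3≤L distinct edges chordless e = record
    { size = 3≤L ; distinct = λ i<j j≤L → trans (same-≡ _ _) (distinct i<j j≤L)
    ; edge = adj-kept ∘ edges ; closing = adj-uv ; chordless = chordless′ }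
    where
    open AddsEdge e
    index-injective : ∀ {p q} → p ≤ L → q ≤ L → same G (w p) (w q) ≡ true → p ≡ q
    index-injective {p} {q} p≤L q≤L h with <-cmp p q
    ... | tri< p<q _ _ = ⊥-elim (≡true⇒≢false h (distinct p<q q≤L))
    ... | tri≈ _ p≡q _ = p≡q
    ... | tri> _ _ q<p = ⊥-elim (≡true⇒≢false (same-sym h) (distinct q<p p≤L))
    chordless′ : ∀ {i j} → suc i < j → j ≤ L → 0 < i ⊎ j < L → adj G′ (w i) (w j) ≡ false
    chordless′ {i} {j} 1+i<j j≤L inner = ¬-not λ h → new-chord (adj-new h)
      where
      i≤L : i ≤ L
      i≤L = <⇒≤ (<-trans (n<1+n i) (<-≤-trans 1+i<j j≤L))
      new-chord : _ → ⊥
      new-chord (inj₁ p) = ≡true⇒≢false p (chordless 1+i<j j≤L)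
      new-chord (inj₂ (inj₁ (p , q))) with index-injective i≤L z≤n p | index-injective j≤L ≤-refl q
      ... | refl | refl = [ (λ ()) , <-irrefl refl ]′ inner
      new-chord (inj₂ (inj₂ (_ , q))) with index-injective j≤L z≤n q
      ... | refl = n≮0 1+i<j

  hole-prefix : ∀ {m f q G′} → Hole G m f → 3 ≤ q → q < m → AddsEdge G G′ (f 0) (f q) → Hole G′ q f
  hole-prefix {m} H 3≤q q<m = path-close 3≤q
    (λ i<j j≤q → distinct i<j (≤-trans j≤q (<⇒≤ q<m)))
    (λ i<q → edge (<-trans i<q q<m))
    (λ 1+i<j j≤q → chordless 1+i<j (≤-trans j≤q (<⇒≤ q<m)) (inj₂ (≤-<-trans j≤q q<m)))
    where open Hole H

  hole-untouched : ∀ {m f u v G′} → Hole G m f → AddsEdge G G′ u v →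
                   (∀ p → p ≤ m → same G (f p) u ≡ false) ⊎ (∀ p → p ≤ m → same G (f p) v ≡ false) →
                   Hole G′ m f
  hole-untouched {m} {f} {G′ = G′} H e avoids = record
    { size = size ; distinct = λ i<j j≤m → trans (same-≡ _ _) (distinct i<j j≤m)
    ; edge = adj-kept ∘ edge ; closing = adj-kept closing ; chordless = chordless′ }
    where
    open Hole H
    open AddsEdge e
    chordless′ : ∀ {i j} → suc i < j → j ≤ m → 0 < i ⊎ j < m → adj G′ (f i) (f j) ≡ false
    chordless′ {i} {j} 1+i<j j≤m inner = ¬-not λ h → new-chord (adj-new h) avoids
      where
      i≤m : i ≤ m
      i≤m = <⇒≤ (<-trans (n<1+n i) (<-≤-trans 1+i<j j≤m))
      new-chord : _ → _ → ⊥
      new-chord (inj₁ p)              _         = ≡true⇒≢false p (chordless 1+i<j j≤m inner)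
      new-chord (inj₂ (inj₁ (p , _))) (inj₁ ¬u) = ≡true⇒≢false p (¬u i i≤m)
      new-chord (inj₂ (inj₁ (_ , q))) (inj₂ ¬v) = ≡true⇒≢false q (¬v j j≤m)
      new-chord (inj₂ (inj₂ (_ , q))) (inj₁ ¬u) = ≡true⇒≢false q (¬u j j≤m)
      new-chord (inj₂ (inj₂ (p , _))) (inj₂ ¬v) = ≡true⇒≢false p (¬v i i≤m)

  -- Rotate until the new edge starts at f 0; it then closes a shorter hole on
  -- the side f 0 … f q, or, when q = 2, on the other side f 2 … f m, f 0.
  hole-chord : ∀ {m G′} → 4 ≤ m → ∀ p {q f} → Hole G m f → p < q → q ≤ m →
               adj G (f p) (f q) ≡ false → AddsEdge G G′ (f p) (f q) → HasHole G′
  hole-chord 4≤m zero {1} H _ _ f₀≁f₁ _ =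
    ⊥-elim (≡true⇒≢false (Hole.edge H (<-≤-trans z<s 4≤m)) f₀≁f₁)
  hole-chord {suc m} (s≤s 3≤m) zero {2} {f} H _ _ _ e =
    m , g , hole-prefix (hole-rotate (hole-rotate H)) 3≤m ≤-refl
              (AddsEdge-cong (sym g0) (sym gm) (AddsEdge-sym e))
    where
    g = rotate (suc m) (rotate (suc m) f)
    g0 : g 0 ≡ f 2
    g0 = trans (rotate-< {suc m} {rotate (suc m) f} z<s) (rotate-< {suc m} {f} (s≤s (<-≤-trans z<s 3≤m)))
    gm : g m ≡ f 0
    gm = trans (rotate-< {suc m} {rotate (suc m) f} ≤-refl) (rotate-last {suc m} {f})
  hole-chord {m} 4≤m zero {suc (suc (suc q))} {f} H _ q≤m f₀≁fq e with suc (suc (suc q)) ≟ℕ m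
  ... | yes refl = ⊥-elim (≡true⇒≢false (Hole.closing H) f₀≁fq)
  ... | no  q≢m  = _ , f , hole-prefix H (s≤s (s≤s (s≤s z≤n))) (≤∧≢⇒< q≤m q≢m) e
  hole-chord {m} 4≤m (suc p) {suc q} {f} H (s≤s p<q) q≤m fp≁fq e =
    hole-chord 4≤m p {q} {rotate m f} (hole-rotate H) p<q (<⇒≤ q≤m)
      (subst₂ (λ a b → adj G a b ≡ false) (sym gp) (sym gq) fp≁fq) (AddsEdge-cong (sym gp) (sym gq) e)
    where
    gp : rotate m f p ≡ f (suc p)
    gp = rotate-< {m} {f} (<-trans p<q q≤m)
    gq : rotate m f q ≡ f (suc q)
    gq = rotate-< {m} {f} q≤m

  same-cases : ∀ a b → same G a b ≡ true ⊎ same G a b ≡ false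
  same-cases a b = bool-cases (same G a b) inj₁ inj₂

  addEdge-long-hole : ∀ {m f x y} → Hole G m f → 4 ≤ m → same G x y ≡ false → adj G x y ≡ false →
                      HasHole (addEdge G x y)
  addEdge-long-hole {m} {f} {x} {y} H 4≤m x≉y x≁y
    with bounded-search (λ p → same-cases (f p) x) (suc m) | bounded-search (λ p → same-cases (f p) y) (suc m)
  ... | inj₂ ¬x | _ = m , f , hole-untouched H (addEdge-AddsEdge agg (same-refl x) (same-refl y))
                                (inj₁ λ p p≤m → ¬x p (s≤s p≤m))
  ... | inj₁ _ | inj₂ ¬y = m , f , hole-untouched H (addEdge-AddsEdge agg (same-refl x) (same-refl y))
                                     (inj₂ λ p p≤m → ¬y p (s≤s p≤m))
  ... | inj₁ (p , p<1+m , fp≈x) | inj₁ (q , q<1+m , fq≈y) with <-cmp p q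
  ...   | tri< p<q _ _ = hole-chord 4≤m p H p<q (s≤s⁻¹ q<1+m) (adj-respᶠ fp≈x fq≈y x≁y)
                           (addEdge-AddsEdge agg fp≈x fq≈y)
  ...   | tri≈ _ refl _ = ⊥-elim (≡true⇒≢false (same-trans (same-sym fp≈x) fq≈y) x≉y)
  ...   | tri> _ _ q<p = hole-chord 4≤m q H q<p (s≤s⁻¹ p<1+m) (adj-symᶠ (adj-respᶠ fp≈x fq≈y x≁y))
                           (AddsEdge-sym (addEdge-AddsEdge agg fp≈x fq≈y))

allᵇ-true⁻ : ∀ {X : Set} {p : X → Bool} {as : List X} {c} → allᵇ p as ≡ true → c ∈ as → p c ≡ true
allᵇ-true⁻ {p = p} {a ∷ _}  h (here refl) = proj₁ (∧-true⁻ {p a} h)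
allᵇ-true⁻ {p = p} {a ∷ as} h (there c∈)  = allᵇ-true⁻ {as = as} (proj₂ (∧-true⁻ {p a} h)) c∈

complete-no-hole : ∀ {n} {G : AGraph n} → Complete G → ¬ HasHole G
complete-no-hole {n} {G} full (m , f , H) =
  [ (λ f₀≈f₂ → ≡true⇒≢false f₀≈f₂ (distinct z<s 2≤m))
  , (λ f₀∼f₂ → ≡true⇒≢false f₀∼f₂ (chordless (s≤s z<s) 2≤m (inj₂ size))) ]′
  (∨-true⁻ {same G (f 0) (f 2)} f₀-f₂)
  where
  open Hole H
  2≤m : 2 ≤ m
  2≤m = ≤-trans (n≤1+n 2) size
  f₀-f₂ : same G (f 0) (f 2) ∨ adj G (f 0) (f 2) ≡ true
  f₀-f₂ = allᵇ-true⁻ {as = allFin n} (allᵇ-true⁻ {as = allFin n} full (∈-allFin (f 0))) (∈-allFin (f 2))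

toFin : (m i : ℕ) → Fin (suc m)
toFin zero    _       = fzero
toFin (suc m) zero    = fzero
toFin (suc m) (suc i) = fsuc (toFin m i)

toℕ-toFin : ∀ {m i} → i ≤ m → toℕ (toFin m i) ≡ i
toℕ-toFin {zero}  z≤n       = refl
toℕ-toFin {suc m} z≤n       = refl
toℕ-toFin {suc m} (s≤s i≤m) = cong suc (toℕ-toFin i≤m)

module InducedCycles {n} {G : AGraph n} (agg : IsAggregated G) where
  open IsAggregated agg

  inducedCycle⇒hole : ∀ {m c} → InducedCycle G (suc m) c → 3 ≤ m → Hole G m (c ∘ toFin m)
  inducedCycle⇒hole {m} {c} C 3≤m = record
    { size = 3≤m ; distinct = distinct′ ; edge = edge′ ; closing = closing′ ; chordless = chordless′ }
    where
    open InducedCycle C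
    T = toFin m
    distinct′ : ∀ {i j} → i < j → j ≤ m → same G (c (T i)) (c (T j)) ≡ false
    distinct′ {i} {j} i<j j≤m = ¬-not (distinct (T i) (T j) λ Ti≡Tj → <-irrefl
      (trans (sym (toℕ-toFin (<⇒≤ (<-≤-trans i<j j≤m)))) (trans (cong toℕ Ti≡Tj) (toℕ-toFin j≤m))) i<j)
    edge′ : ∀ {i} → i < m → adj G (c (T i)) (c (T (suc i))) ≡ true
    edge′ {i} i<m = Equivalence.from (adjacency (T i) (T (suc i)))
      (inj₁ (inj₁ (trans (cong suc (toℕ-toFin (<⇒≤ i<m))) (sym (toℕ-toFin i<m)))))
    closing′ : adj G (c (T 0)) (c (T m)) ≡ true
    closing′ = Equivalence.from (adjacency (T 0) (T m))
      (inj₂ (inj₂ (cong suc (toℕ-toFin ≤-refl) , toℕ-toFin {m} z≤n)))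
    chordless′ : ∀ {i j} → suc i < j → j ≤ m → 0 < i ⊎ j < m → adj G (c (T i)) (c (T j)) ≡ false
    chordless′ {i} {j} 1+i<j j≤m inner = ¬-not λ h → not-consecutive (Equivalence.to (adjacency (T i) (T j)) h)
      where
      Ti≡i : toℕ (T i) ≡ i
      Ti≡i = toℕ-toFin (<⇒≤ (<-≤-trans (<-trans (n<1+n i) 1+i<j) j≤m))
      Tj≡j : toℕ (T j) ≡ j
      Tj≡j = toℕ-toFin j≤m
      not-consecutive : CycNext (T i) (T j) ⊎ CycNext (T j) (T i) → ⊥
      not-consecutive (inj₁ (inj₁ p)) rewrite Ti≡i | Tj≡j | p = <-irrefl refl 1+i<j
      not-consecutive (inj₁ (inj₂ (_ , q))) rewrite Tj≡j | q = n≮0 1+i<j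
      not-consecutive (inj₂ (inj₁ p)) rewrite Ti≡i | Tj≡j | sym p =
        <-irrefl refl (<-trans (n<1+n j) (<-trans (n<1+n (suc j)) 1+i<j))
      not-consecutive (inj₂ (inj₂ (p , q))) rewrite Ti≡i | Tj≡j | q | suc-injective p =
        [ (λ ()) , <-irrefl refl ]′ inner

  hole⇒inducedCycle : ∀ {m f} → Hole G m f → InducedCycle G (suc m) (f ∘ toℕ)
  hole⇒inducedCycle {m} {f} H = record
    { length≥3 = m≤n⇒m≤1+n size ; distinct = distinct′ ; adjacency = λ i j → mk⇔ (to i j) (from i j) }
    where
    open Hole H
    bound : ∀ (i : Fin (suc m)) → toℕ i ≤ m
    bound i = s≤s⁻¹ (toℕ<n i)
    distinct′ : ∀ i j → i ≢ j → ¬ Same G (f (toℕ i)) (f (toℕ j))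
    distinct′ i j i≢j h with <-cmp (toℕ i) (toℕ j)
    ... | tri< i<j _ _ = ≡true⇒≢false h (distinct i<j (bound j))
    ... | tri≈ _ i≡j _ = i≢j (toℕ-injective i≡j)
    ... | tri> _ _ j<i = ≡true⇒≢false (same-sym h) (distinct j<i (bound i))
    next-adj : ∀ i j → CycNext i j → Adj G (f (toℕ i)) (f (toℕ j))
    next-adj i j (inj₁ p) rewrite sym p = edge (<-≤-trans (n<1+n (toℕ i)) (subst (_≤ m) (sym p) (bound j)))
    next-adj i j (inj₂ (p , q)) rewrite q | suc-injective p = adj-sym closing
    from : ∀ i j → CycNext i j ⊎ CycNext j i → Adj G (f (toℕ i)) (f (toℕ j))
    from i j (inj₁ i→j) = next-adj i j i→j
    from i j (inj₂ j→i) = adj-sym (next-adj j i j→i)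
    to-< : ∀ i j → toℕ i < toℕ j → Adj G (f (toℕ i)) (f (toℕ j)) → CycNext i j ⊎ CycNext j i
    to-< i j i<j h with toℕ j ≟ℕ suc (toℕ i) | toℕ i ≟ℕ 0 | toℕ j ≟ℕ m
    ... | yes j≡1+i | _        | _       = inj₁ (inj₁ (sym j≡1+i))
    ... | no  _     | yes i≡0  | yes j≡m = inj₂ (inj₂ (cong suc j≡m , i≡0))
    ... | no  j≢1+i | yes _    | no  j≢m = ⊥-elim (≡true⇒≢false h
            (chordless (≤∧≢⇒< i<j (j≢1+i ∘ sym)) (bound j) (inj₂ (≤∧≢⇒< (bound j) j≢m))))
    ... | no  j≢1+i | no  i≢0  | _       = ⊥-elim (≡true⇒≢false h
            (chordless (≤∧≢⇒< i<j (j≢1+i ∘ sym)) (bound j) (inj₁ (≤∧≢⇒< z≤n (i≢0 ∘ sym)))))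
    to : ∀ i j → Adj G (f (toℕ i)) (f (toℕ j)) → CycNext i j ⊎ CycNext j i
    to i j h with <-cmp (toℕ i) (toℕ j)
    ... | tri< i<j _ _ = to-< i j i<j h
    ... | tri≈ _ i≡j _ =
      ⊥-elim (adj-irrefl h (subst (λ k → same G (f (toℕ i)) (f k) ≡ true) i≡j (same-refl _)))
    ... | tri> _ _ j<i = swap (to-< j i j<i (adj-sym h))

record Square {n} (G : AGraph n) (a b c d : Fin n) : Set where
  field
    a≉b : same G a b ≡ false
    a≉c : same G a c ≡ false
    a≉d : same G a d ≡ false
    b≉c : same G b c ≡ false
    b≉d : same G b d ≡ false
    c≉d : same G c d ≡ false
    a∼b : adj G a b ≡ true
    b∼c : adj G b c ≡ true
    c∼d : adj G c d ≡ true
    d∼a : adj G d a ≡ true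
    a≁c : adj G a c ≡ false
    b≁d : adj G b d ≡ false

SquareFree : ∀ {n} → AGraph n → Set
SquareFree G = ∀ {a b c d} → ¬ Square G a b c d

module Squares {n} {G : AGraph n} (agg : IsAggregated G) where
  open IsAggregated agg

  square-rotate : ∀ {a b c d} → Square G a b c d → Square G b c d a
  square-rotate S = record
    { a≉b = b≉c ; a≉c = b≉d ; a≉d = same-symᶠ a≉b
    ; b≉c = c≉d ; b≉d = same-symᶠ a≉c ; c≉d = same-symᶠ a≉d
    ; a∼b = b∼c ; b∼c = c∼d ; c∼d = d∼a ; d∼a = a∼b ; a≁c = b≁d ; b≁d = adj-symᶠ a≁c }
    where open Square S

  hole⇒square : ∀ {f} → Hole G 3 f → Square G (f 0) (f 1) (f 2) (f 3)
  hole⇒square H = record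
    { a≉b = distinct (s≤s z≤n) (s≤s z≤n) ; a≉c = distinct (s≤s z≤n) (s≤s (s≤s z≤n))
    ; a≉d = distinct (s≤s z≤n) ≤-refl
    ; b≉c = distinct (s≤s (s≤s z≤n)) (s≤s (s≤s z≤n)) ; b≉d = distinct (s≤s (s≤s z≤n)) ≤-refl
    ; c≉d = distinct ≤-refl ≤-refl
    ; a∼b = edge (s≤s z≤n) ; b∼c = edge (s≤s (s≤s z≤n)) ; c∼d = edge ≤-refl ; d∼a = adj-sym closing
    ; a≁c = chordless (s≤s (s≤s z≤n)) (s≤s (s≤s z≤n)) (inj₂ ≤-refl)
    ; b≁d = chordless ≤-refl ≤-refl (inj₁ (s≤s z≤n)) }
    where open Hole H

  inducedC4⇒square : HasInducedC4 G → Σ (ℕ → Fin n) λ f → Square G (f 0) (f 1) (f 2) (f 3)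
  inducedC4⇒square (c , C) = c ∘ toFin 3 , hole⇒square (InducedCycles.inducedCycle⇒hole agg C ≤-refl)

  square-reflect : ∀ {a b c d} → Square G a b c d → Square G d c b a
  square-reflect S = record
    { a≉b = same-symᶠ c≉d ; a≉c = same-symᶠ b≉d ; a≉d = same-symᶠ a≉d ; b≉c = same-symᶠ b≉c
    ; b≉d = same-symᶠ a≉c ; c≉d = same-symᶠ a≉b
    ; a∼b = adj-sym c∼d ; b∼c = adj-sym b∼c ; c∼d = adj-sym a∼b ; d∼a = adj-sym d∼a
    ; a≁c = adj-symᶠ b≁d ; b≁d = adj-symᶠ a≁c }
    where open Square S

-- Queries separated by their common neighbourhood

module SeparatedQuery {n} {G : AGraph n} (agg : IsAggregated G) {u v : Fin n}
                      (u≉v : same G u v ≡ false) (u≁v : adj G u v ≡ false)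
                      (separated : Separates G (CommonNbhd G u v) u v) (free : SquareFree G) where
  open IsAggregated agg

  private
    T = CommonNbhd G u v
    u∉T = proj₁ separated
    v∉T = proj₁ (proj₂ separated)
    no-walk = proj₂ (proj₂ separated)
    G⁺ = addEdge G u v
    Gₘ = merge G u v
    I = inMerged G u v
    agg⁺ = addEdge-isAggregated agg u≉v
    module S⁺ = Squares agg⁺

  addEdge-adj-away : ∀ {p q} → same G p u ≡ false → same G p v ≡ false →
                     adj G⁺ p q ≡ true → adj G p q ≡ true
  addEdge-adj-away p≉u p≉v h with addEdge-adj⁻ G u v h
  ... | inj₁ old             = old
  ... | inj₂ (inj₁ (p≈u , _)) = ⊥-elim (≡true⇒≢false p≈u p≉u)
  ... | inj₂ (inj₂ (p≈v , _)) = ⊥-elim (≡true⇒≢false p≈v p≉v)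

  addEdge-nonadj : ∀ {p q} → adj G⁺ p q ≡ false → adj G p q ≡ false
  addEdge-nonadj f = ¬-not (λ h → ≡true⇒≢false (addEdge-keeps-adj G u v h) f)

  -- u, b, c, v would be a walk from u to v avoiding N(u) ∩ N(v).
  square-on-new-edge : ∀ {a b c d} → Square G⁺ a b c d → same G a u ≡ true → same G d v ≡ true → ⊥
  square-on-new-edge {a} {b} {c} {d} S a≈u d≈v =
    no-walk (step u∉T u∼b (step b∉T b∼ᴳc (step c∉T c∼v (nil v∉T))))
    where
    open Square S
    b≉u = same-respʳᶠ a≈u (same-symᶠ a≉b)
    b≉v = same-respʳᶠ d≈v b≉d
    c≉u = same-respʳᶠ a≈u (same-symᶠ a≉c)
    c≉v = same-respʳᶠ d≈v c≉d
    u∼b = adj-respˡ a≈u (adj-sym (addEdge-adj-away b≉u b≉v (IsAggregated.adj-sym agg⁺ a∼b)))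
    b∼ᴳc = addEdge-adj-away b≉u b≉v b∼c
    c∼v = adj-respʳ d≈v (addEdge-adj-away c≉u c≉v c∼d)
    b∉T : ¬ T b
    b∉T (_ , b∼v) = ≡true⇒≢false (adj-respʳ (same-sym d≈v) b∼v) (addEdge-nonadj b≁d)
    c∉T : ¬ T c
    c∉T (c∼u , _) = ≡true⇒≢false (adj-sym (adj-respʳ (same-sym a≈u) c∼u)) (addEdge-nonadj a≁c)

  square-closed-by-new-edge : ∀ {a b c d} → Square G⁺ a b c d → adj G d a ≡ false → ⊥
  square-closed-by-new-edge S d≁a with addEdge-adj⁻ G u v (Square.d∼a S)
  ... | inj₁ d∼a              = ≡true⇒≢false d∼a d≁a
  ... | inj₂ (inj₁ (d≈u , a≈v)) = square-on-new-edge (S⁺.square-reflect S) d≈u a≈v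
  ... | inj₂ (inj₂ (d≈v , a≈u)) = square-on-new-edge S a≈u d≈v

  addEdge-squareFree : SquareFree G⁺
  addEdge-squareFree {a} {b} {c} {d} S
    with adj G a b in a∼ᴳb | adj G b c in b∼ᴳc | adj G c d in c∼ᴳd | adj G d a in d∼ᴳa
  ... | false | _     | _     | _     = square-closed-by-new-edge (S⁺.square-rotate S) a∼ᴳb
  ... | true  | false | _     | _     = square-closed-by-new-edge (S⁺.square-rotate (S⁺.square-rotate S)) b∼ᴳc
  ... | true  | true  | false | _     =
    square-closed-by-new-edge (S⁺.square-rotate (S⁺.square-rotate (S⁺.square-rotate S))) c∼ᴳd
  ... | true  | true  | true  | false = square-closed-by-new-edge S d∼ᴳa
  ... | true  | true  | true  | true  = free record
    { a≉b = a≉b ; a≉c = a≉c ; a≉d = a≉d ; b≉c = b≉c ; b≉d = b≉d ; c≉d = c≉d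
    ; a∼b = a∼ᴳb ; b∼c = b∼ᴳc ; c∼d = c∼ᴳd ; d∼a = d∼ᴳa
    ; a≁c = addEdge-nonadj a≁c ; b≁d = addEdge-nonadj b≁d }
    where open Square S

  private
    aggₘ = Merge.merge-isAggregated agg u≁v
    module Sₘ = Squares aggₘ
  open Merge agg u≁v

  square-at-merged-vertex : ∀ {a b c d} → Square Gₘ a b c d → I a ≡ true → ⊥
  square-at-merged-vertex {a} {b} {c} {d} S Ia =
    corner (adj G u b) (adj G u d) (adj G v b) (adj G v d) refl refl refl refl
    where
    open Square S
    outside : ∀ {p} → same Gₘ a p ≡ false → I p ≡ false
    outside a≉p = ¬-not (λ Ip → ≡true⇒≢false (merge-same-merged Ia Ip) a≉p)
    Ib = outside a≉b
    Ic = outside a≉c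
    Id = outside a≉d
    u≉_ : ∀ {p} → I p ≡ false → same G u p ≡ false
    u≉ Ip = same-symᶠ (proj₁ (∨-false⁻ Ip))
    v≉_ : ∀ {p} → I p ≡ false → same G v p ≡ false
    v≉ Ip = same-symᶠ (proj₂ (∨-false⁻ Ip))
    u∨v∼b : adj G u b ∨ adj G v b ≡ true
    u∨v∼b = subst (_≡ true) (merge-adj-from G u v Ia) a∼b
    u∨v∼d : adj G u d ∨ adj G v d ≡ true
    u∨v∼d = subst (_≡ true) (merge-adj-from G u v Ia) (IsAggregated.adj-sym aggₘ d∼a)
    u∨v≁c : adj G u c ∨ adj G v c ≡ false
    u∨v≁c = subst (_≡ false) (merge-adj-from G u v Ia) a≁c
    b∼ᴳc = subst (_≡ true) (merge-adj-outside G u v Ib Ic) b∼c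
    c∼ᴳd = subst (_≡ true) (merge-adj-outside G u v Ic Id) c∼d
    b≁ᴳd = subst (_≡ false) (merge-adj-outside G u v Ib Id) b≁d
    x-square : ∀ {x} → adj G x b ≡ true → adj G x d ≡ true → adj G x c ≡ false →
               same G x b ≡ false → same G x c ≡ false → same G x d ≡ false → Square G x b c d
    x-square x∼b x∼d x≁c x≉b x≉c x≉d = record
      { a≉b = x≉b ; a≉c = x≉c ; a≉d = x≉d
      ; b≉c = trans (sym (merge-same-outside G u v Ib)) b≉c
      ; b≉d = trans (sym (merge-same-outside G u v Ib)) b≉d
      ; c≉d = trans (sym (merge-same-outside G u v Ic)) c≉d
      ; a∼b = x∼b ; b∼c = b∼ᴳc ; c∼d = c∼ᴳd ; d∼a = adj-sym x∼d ; a≁c = x≁c ; b≁d = b≁ᴳd }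
    u≁c = proj₁ (∨-false⁻ u∨v≁c)
    v≁c = proj₂ (∨-false⁻ u∨v≁c)
    c∉T : ¬ T c
    c∉T (c∼u , _) = ≡true⇒≢false (adj-sym c∼u) u≁c
    corner : ∀ ub ud vb vd → adj G u b ≡ ub → adj G u d ≡ ud → adj G v b ≡ vb → adj G v d ≡ vd → ⊥
    corner true  true  _     _     u∼b u∼d _   _   = free (x-square u∼b u∼d u≁c (u≉ Ib) (u≉ Ic) (u≉ Id))
    corner _     _     true  true  _   _   v∼b v∼d = free (x-square v∼b v∼d v≁c (v≉ Ib) (v≉ Ic) (v≉ Id))
    corner true  false false true  u∼b u≁d v≁b v∼d =
      no-walk (step u∉T u∼b (step b∉T b∼ᴳc (step c∉T c∼ᴳd (step d∉T (adj-sym v∼d) (nil v∉T)))))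
      where
      b∉T : ¬ T b
      b∉T (_ , b∼v) = ≡true⇒≢false (adj-sym b∼v) v≁b
      d∉T : ¬ T d
      d∉T (d∼u , _) = ≡true⇒≢false (adj-sym d∼u) u≁d
    corner false true  true  false u≁b u∼d v∼b v≁d =
      no-walk (step u∉T u∼d (step d∉T (adj-sym c∼ᴳd)
                (step c∉T (adj-sym b∼ᴳc) (step b∉T (adj-sym v∼b) (nil v∉T)))))
      where
      b∉T : ¬ T b
      b∉T (b∼u , _) = ≡true⇒≢false (adj-sym b∼u) u≁b
      d∉T : ¬ T d
      d∉T (_ , d∼v) = ≡true⇒≢false (adj-sym d∼v) v≁d
    corner _     false _     false _   u≁d _   v≁d = ≡true⇒≢false u∨v∼d (∨-false u≁d v≁d)
    corner false _     false _     u≁b _   v≁b _   = ≡true⇒≢false u∨v∼b (∨-false u≁b v≁b)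

  merge-squareFree : SquareFree Gₘ
  merge-squareFree {a} {b} {c} {d} S with I a in Ia | I b in Ib | I c in Ic | I d in Id
  ... | true  | _     | _     | _     = square-at-merged-vertex S Ia
  ... | false | true  | _     | _     = square-at-merged-vertex (Sₘ.square-rotate S) Ib
  ... | false | false | true  | _     = square-at-merged-vertex (Sₘ.square-rotate (Sₘ.square-rotate S)) Ic
  ... | false | false | false | true  =
    square-at-merged-vertex (Sₘ.square-rotate (Sₘ.square-rotate (Sₘ.square-rotate S))) Id
  ... | false | false | false | false = free record
    { a≉b = trans (sym (merge-same-outside G u v Ia)) a≉b ; a≉c = trans (sym (merge-same-outside G u v Ia)) a≉c
    ; a≉d = trans (sym (merge-same-outside G u v Ia)) a≉d ; b≉c = trans (sym (merge-same-outside G u v Ib)) b≉c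
    ; b≉d = trans (sym (merge-same-outside G u v Ib)) b≉d ; c≉d = trans (sym (merge-same-outside G u v Ic)) c≉d
    ; a∼b = trans (sym (merge-adj-outside G u v Ia Ib)) a∼b ; b∼c = trans (sym (merge-adj-outside G u v Ib Ic)) b∼c
    ; c∼d = trans (sym (merge-adj-outside G u v Ic Id)) c∼d ; d∼a = trans (sym (merge-adj-outside G u v Id Ia)) d∼a
    ; a≁c = trans (sym (merge-adj-outside G u v Ia Ic)) a≁c ; b≁d = trans (sym (merge-adj-outside G u v Ib Id)) b≁d }
    where open Square S

record Path {n} (G : AGraph n) (T : Fin n → Set) (u v : Fin n) (L : ℕ) (w : ℕ → Fin n) : Set where
  field
    start : w 0 ≡ u
    end   : w L ≡ v
    edges : ∀ {i} → i < L → adj G (w i) (w (suc i)) ≡ true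
    avoid : ∀ {i} → i ≤ L → ¬ T (w i)

walk⇒path : ∀ {n} {G : AGraph n} {T u v} → Walk G T u v →
            Σ ℕ λ L → Σ (ℕ → Fin n) λ w → Path G T u v L w
walk⇒path {u = u} (nil u∉T) =
  0 , (λ _ → u) , record { start = refl ; end = refl ; edges = λ () ; avoid = λ _ → u∉T }
walk⇒path {G = G} {T} {u} (step {b = b} u∉T u∼b W) with walk⇒path W
... | L , w , P = suc L , w′ , record { start = refl ; end = end ; edges = edges′ ; avoid = avoid′ }
  where
  open Path P
  w′ : ℕ → Fin _
  w′ zero    = u
  w′ (suc k) = w k
  edges′ : ∀ {i} → i < suc L → adj G (w′ i) (w′ (suc i)) ≡ true
  edges′ {zero}  _         = subst (λ z → adj G u z ≡ true) (sym start) u∼b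
  edges′ {suc i} (s≤s i<L) = edges i<L
  avoid′ : ∀ {i} → i ≤ suc L → ¬ T (w′ i)
  avoid′ {zero}  _         = u∉T
  avoid′ {suc i} (s≤s i≤L) = avoid i≤L

skip : ∀ {n} → ℕ → ℕ → (ℕ → Fin n) → ℕ → Fin n
skip i gap w k with k ≤? i
... | yes _ = w k
... | no  _ = w (k + gap)

skip-≤ : ∀ {n} {i gap k} {w : ℕ → Fin n} → k ≤ i → skip i gap w k ≡ w k
skip-≤ {i = i} {k = k} k≤i with k ≤? i
... | yes _   = refl
... | no  k≰i = ⊥-elim (k≰i k≤i)

skip-> : ∀ {n} {i gap k} {w : ℕ → Fin n} → i < k → skip i gap w k ≡ w (k + gap)
skip-> {i = i} {k = k} i<k with k ≤? i
... | yes k≤i = ⊥-elim (<-irrefl refl (<-≤-trans i<k k≤i))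
... | no  _   = refl

path-shortcut : ∀ {n} {G : AGraph n} {T u v L w} → Path G T u v L w → ∀ {i j} → suc i < j → j ≤ L →
                adj G (w i) (w j) ≡ true →
                Σ ℕ λ L′ → Σ (ℕ → Fin n) λ w′ → L′ < L × Path G T u v L′ w′
path-shortcut {n} {G} {T} {u} {v} {L} {w} P {i} {j} 1+i<j j≤L wi∼wj =
  L′ , skip i gap w , L′<L , record { start = start′ ; end = end′ ; edges = edges′ ; avoid = avoid′ }
  where
  open Path P
  gap = j ∸ suc i
  L′ = L ∸ gap
  i+gap : suc i + gap ≡ j
  i+gap = m+[n∸m]≡n (<⇒≤ 1+i<j)
  L′+gap : L′ + gap ≡ L
  L′+gap = m∸n+n≡m (≤-trans (m∸n≤m j (suc i)) j≤L)
  0<gap : 0 < gap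
  0<gap = m<n⇒0<n∸m 1+i<j
  i<L′ : i < L′
  i<L′ = +-cancelʳ-≤ gap (suc i) L′ (subst₂ _≤_ (sym i+gap) (sym L′+gap) j≤L)
  L′<L : L′ < L
  L′<L = subst (L′ <_) L′+gap (m<m+n L′ 0<gap)
  start′ : skip i gap w 0 ≡ u
  start′ = trans (skip-≤ {i = i} {gap} {w = w} z≤n) start
  end′ : skip i gap w L′ ≡ v
  end′ = trans (skip-> {i = i} {gap} {w = w} i<L′) (trans (cong w L′+gap) end)
  edges′ : ∀ {k} → k < L′ → adj G (skip i gap w k) (skip i gap w (suc k)) ≡ true
  edges′ {k} k<L′ with <-cmp k i
  ... | tri< k<i _ _ rewrite skip-≤ {i = i} {gap} {k} {w} (<⇒≤ k<i) | skip-≤ {i = i} {gap} {suc k} {w} k<i =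
    edges (<-trans k<i (<-trans i<L′ L′<L))
  ... | tri≈ _ refl _ rewrite skip-≤ {i = i} {gap} {k} {w} ≤-refl | skip-> {i = i} {gap} {suc k} {w} ≤-refl | i+gap =
    wi∼wj
  ... | tri> _ _ i<k rewrite skip-> {i = i} {gap} {k} {w} i<k | skip-> {i = i} {gap} {suc k} {w} (<-trans i<k (n<1+n k)) =
    edges (subst (k + gap <_) L′+gap (+-monoˡ-< gap k<L′))
  avoid′ : ∀ {k} → k ≤ L′ → ¬ T (skip i gap w k)
  avoid′ {k} k≤L′ with k ≤? i
  ... | yes _ = avoid (≤-trans k≤L′ (<⇒≤ L′<L))
  ... | no  _ = avoid (subst (k + gap ≤_) L′+gap (+-monoˡ-≤ gap k≤L′))

find-chord : ∀ {n} (G : AGraph n) L (w : ℕ → Fin n) →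
             (Σ ℕ λ j → j ≤ L × Σ ℕ λ i → suc i < j × adj G (w i) (w j) ≡ true) ⊎ Chordless G L w
find-chord G L w with bounded-search chord-to (suc L)
  where
  chord-to : ∀ j → (Σ ℕ λ i → suc i < j × adj G (w i) (w j) ≡ true) ⊎
                   (∀ i → suc i < j → adj G (w i) (w j) ≡ false)
  chord-to j with bounded-search (chord-from j) j
    where
    chord-from : ∀ j i → (suc i < j × adj G (w i) (w j) ≡ true) ⊎ (suc i < j → adj G (w i) (w j) ≡ false)
    chord-from j i with suc i <? j
    ... | yes 1+i<j = bool-cases (adj G (w i) (w j)) (λ h → inj₁ (1+i<j , h)) (λ h → inj₂ λ _ → h)
    ... | no  1+i≮j = inj₂ λ 1+i<j → ⊥-elim (1+i≮j 1+i<j)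
  ... | inj₁ (i , _ , chord) = inj₁ (i , chord)
  ... | inj₂ none            = inj₂ λ i 1+i<j → none i (<-trans (n<1+n i) 1+i<j) 1+i<j
... | inj₁ (j , j<1+L , i , chord) = inj₁ (j , s≤s⁻¹ j<1+L , i , chord)
... | inj₂ none                    = inj₂ λ {i} {j} 1+i<j j≤L → none j (s≤s j≤L) i 1+i<j

path⇒chordless-path : ∀ {n} {G : AGraph n} {T u v L w} → Path G T u v L w →
                      Σ ℕ λ L′ → Σ (ℕ → Fin n) λ w′ → Path G T u v L′ w′ × Chordless G L′ w′
path⇒chordless-path {L = L} = go (<-wellFounded L)
  where
  go : ∀ {n} {G : AGraph n} {T u v L w} → Acc _<_ L → Path G T u v L w →
       Σ ℕ λ L′ → Σ (ℕ → Fin n) λ w′ → Path G T u v L′ w′ × Chordless G L′ w′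
  go {G = G} {L = L} {w} (acc smaller) P with find-chord G L w
  ... | inj₂ chordless = L , w , P , chordless
  ... | inj₁ (j , j≤L , i , 1+i<j , wi∼wj) with path-shortcut P 1+i<j j≤L wi∼wj
  ...   | L′ , w′ , L′<L , P′ = go (smaller L′<L) P′

module PathHoles {n} {G : AGraph n} (agg : IsAggregated G) where
  open IsAggregated agg

  chordless-path-distinct : ∀ {T u v L w} → same G u v ≡ false → Path G T u v L w → Chordless G L w →
                            ∀ {i j} → i < j → j ≤ L → same G (w i) (w j) ≡ false
  chordless-path-distinct {L = L} {w} u≉v P chordless {i} {j} i<j j≤L = ¬-not (repeated (m≤n⇒m<n∨m≡n j≤L))
    where
    open Path P
    repeated : j < L ⊎ j ≡ L → same G (w i) (w j) ≡ true → ⊥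
    repeated (inj₁ j<L) wi≈wj =
      ≡true⇒≢false (adj-respˡ (same-sym wi≈wj) (edges j<L)) (chordless (s≤s i<j) j<L)
    repeated (inj₂ refl) wi≈wL = repeated-end i i<j wi≈wL
      where
      repeated-end : ∀ i → i < L → same G (w i) (w L) ≡ true → ⊥
      repeated-end zero    _   w₀≈wL = ≡true⇒≢false (subst₂ (λ a b → same G a b ≡ true) start end w₀≈wL) u≉v
      repeated-end (suc i) 1+i<L wi≈wL =
        ≡true⇒≢false (adj-respʳ wi≈wL (edges (<-trans (n<1+n i) 1+i<L))) (chordless 1+i<L ≤-refl)

  walk⇒hole : ∀ {u v} → same G u v ≡ false → adj G u v ≡ false →
              Walk G (CommonNbhd G u v) u v → HasHole (addEdge G u v)
  walk⇒hole {u} {v} u≉v u≁v W with path⇒chordless-path (proj₂ (proj₂ (walk⇒path W)))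
  ... | zero , w , P , _ =
    ⊥-elim (≡true⇒≢false (subst₂ (λ a b → same G a b ≡ true) start end (same-refl (w 0))) u≉v)
    where open Path P
  ... | 1 , w , P , _ = ⊥-elim (≡true⇒≢false (subst₂ (λ a b → adj G a b ≡ true) start end (edges z<s)) u≁v)
    where open Path P
  ... | 2 , w , P , _ = ⊥-elim (avoid (s≤s z≤n)
          ( subst (λ z → adj G (w 1) z ≡ true) start (adj-sym (edges z<s))
          , subst (λ z → adj G (w 1) z ≡ true) end (edges ≤-refl) ))
    where open Path P
  ... | suc (suc (suc L)) , w , P , chordless =
    suc (suc (suc L)) , w ,
    Holes.path-close agg (s≤s (s≤s (s≤s z≤n))) (chordless-path-distinct u≉v P chordless) edges chordless
      (addEdge-AddsEdge agg (subst (λ z → same G (w 0) z ≡ true) start (same-refl _))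
                            (subst (λ z → same G (w _) z ≡ true) end (same-refl _)))
    where open Path P

-- The partition into the vertices of an aggregated graph

firstIndex : ∀ {X : Set} → (X → Bool) → List X → ℕ
firstIndex p []       = 0
firstIndex p (a ∷ as) = if p a then 0 else suc (firstIndex p as)

firstIndex-cong : ∀ {X : Set} {p q : X → Bool} (as : List X) → (∀ a → p a ≡ q a) →
                  firstIndex p as ≡ firstIndex q as
firstIndex-cong []       _ = refl
firstIndex-cong (a ∷ as) f rewrite f a | firstIndex-cong as f = refl

firstIndex-≡⇒common : ∀ {X : Set} {p q : X → Bool} (as : List X) {c} →
                      firstIndex p as ≡ firstIndex q as → c ∈ as → p c ≡ true →
                      Σ X (λ d → p d ≡ true × q d ≡ true)
firstIndex-≡⇒common {p = p} {q} (a ∷ as) e c∈ pc with p a in pa | q a in qa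
... | true  | true  = a , pa , qa
... | true  | false = ⊥-elim (0≢1+n e)
... | false | true  = ⊥-elim (1+n≢0 e)
... | false | false with c∈
...   | here refl = ⊥-elim (≡true⇒≢false pc pa)
...   | there c∈′ = firstIndex-≡⇒common as (suc-injective e) c∈′ pc

vertexPartition : ∀ {n} → AGraph n → Partition n
vertexPartition {n} G a = firstIndex (same G a) (allFin n)

oracle-vertexPartition : ∀ {n} {G : AGraph n} → IsAggregated G → ∀ a b →
                         oracle (vertexPartition G) a b ≡ same G a b
oracle-vertexPartition {n} {G} agg a b = true-iff⇒≡ to from
  where
  open IsAggregated agg
  to : oracle (vertexPartition G) a b ≡ true → same G a b ≡ true
  to h with firstIndex-≡⇒common (allFin n) (isYes-true⁻ _ h) (∈-allFin a) (same-refl a)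
  ... | _ , p , q = same-trans p (same-sym q)
  from : same G a b ≡ true → oracle (vertexPartition G) a b ≡ true
  from h = isYes-true _ (firstIndex-cong (allFin n) (λ c →
             true-iff⇒≡ (same-trans (same-sym h)) (same-trans h)))

-- run S β (suc t) reduces to runStep S β (run S β t).
runStep : ∀ {n} → Strategy n → Partition n → List Bool × AGraph n → List Bool × AGraph n
runStep S β (h , G) =
  if completeᵇ G then (h , G)
  else (let q = S h ; x = proj₁ q ; y = proj₂ q ; b = oracle β x y
        in (b ∷ h) , (if b then merge G x y else addEdge G x y))

runStep-cong : ∀ {n} (S : Strategy n) γ β p →
               (completeᵇ (proj₂ p) ≡ false →
                oracle γ (proj₁ (S (proj₁ p))) (proj₂ (S (proj₁ p))) ≡
                oracle β (proj₁ (S (proj₁ p))) (proj₂ (S (proj₁ p)))) →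
               runStep S γ p ≡ runStep S β p
runStep-cong S γ β (h , G) same-answer with completeᵇ G in e
... | true  = refl
... | false rewrite same-answer refl = refl

module Run {n} (A : ACAlgorithm n) where

  graph : Partition n → ℕ → AGraph n
  graph = graphAt (strategy A)

  qu qv : Partition n → ℕ → Fin n
  qu β t = proj₁ (queryAt (strategy A) β t)
  qv β t = proj₂ (queryAt (strategy A) β t)

  module _ (β : Partition n) (t : ℕ) where

    graph-suc-complete : completeᵇ (graph β t) ≡ true → graph β (suc t) ≡ graph β t
    graph-suc-complete e rewrite e = refl

    graph-suc-merge : completeᵇ (graph β t) ≡ false → oracle β (qu β t) (qv β t) ≡ true →
                      graph β (suc t) ≡ merge (graph β t) (qu β t) (qv β t)
    graph-suc-merge e o rewrite e | o = refl

    graph-suc-addEdge : completeᵇ (graph β t) ≡ false → oracle β (qu β t) (qv β t) ≡ false →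
                        graph β (suc t) ≡ addEdge (graph β t) (qu β t) (qv β t)
    graph-suc-addEdge e o rewrite e | o = refl

    query-distinct : completeᵇ (graph β t) ≡ false → same (graph β t) (qu β t) (qv β t) ≡ false
    query-distinct e = ¬-not (proj₁ (valid A β t (not-¬ e)))

    query-nonadj : completeᵇ (graph β t) ≡ false → adj (graph β t) (qu β t) (qv β t) ≡ false
    query-nonadj e = ¬-not (proj₂ (valid A β t (not-¬ e)))

  graph-isAggregated : ∀ β t → IsAggregated (graph β t)
  graph-isAggregated β zero = G₀-isAggregated
  graph-isAggregated β (suc t) with completeᵇ (graph β t) in e | oracle β (qu β t) (qv β t)
  ... | true  | _     = graph-isAggregated β t
  ... | false | true  = Merge.merge-isAggregated (graph-isAggregated β t) (query-nonadj β t e)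
  ... | false | false = addEdge-isAggregated (graph-isAggregated β t) (query-distinct β t e)

  module _ (β : Partition n) (t : ℕ) (e : completeᵇ (graph β t) ≡ false) where

    graph-suc-same-query : oracle β (qu β t) (qv β t) ≡ true → same (graph β (suc t)) (qu β t) (qv β t) ≡ true
    graph-suc-same-query o = subst (λ H → same H (qu β t) (qv β t) ≡ true) (sym (graph-suc-merge β t e o))
      (merge-same-merged inMerged-x inMerged-y)
      where open Merge (graph-isAggregated β t) (query-nonadj β t e)

    graph-suc-adj-query : oracle β (qu β t) (qv β t) ≡ false → adj (graph β (suc t)) (qu β t) (qv β t) ≡ true
    graph-suc-adj-query o = subst (λ H → adj H (qu β t) (qv β t) ≡ true) (sym (graph-suc-addEdge β t e o))
      (addEdge-adj-xy (graph β t) (qu β t) (qv β t) (same-refl _) (same-refl _))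
      where open IsAggregated (graph-isAggregated β t)

  graph-suc-mono : ∀ β t {a b} →
                   (same (graph β t) a b ≡ true → same (graph β (suc t)) a b ≡ true) ×
                   (adj (graph β t) a b ≡ true → adj (graph β (suc t)) a b ≡ true)
  graph-suc-mono β t with completeᵇ (graph β t) in e | oracle β (qu β t) (qv β t)
  ... | true  | _     = id , id
  ... | false | true  = merge-keeps-same , merge-keeps-adj
    where open Merge (graph-isAggregated β t) (query-nonadj β t e)
  ... | false | false = id , addEdge-keeps-adj (graph β t) (qu β t) (qv β t)

  graph-mono : ∀ β {r t} → r ≤ t → ∀ {a b} →
               (same (graph β r) a b ≡ true → same (graph β t) a b ≡ true) ×
               (adj (graph β r) a b ≡ true → adj (graph β t) a b ≡ true)
  graph-mono β r≤t = go (≤⇒≤′ r≤t)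
    where
    go : ∀ {r t} → r ≤′ t → ∀ {a b} →
         (same (graph β r) a b ≡ true → same (graph β t) a b ≡ true) ×
         (adj (graph β r) a b ≡ true → adj (graph β t) a b ≡ true)
    go ≤′-refl = id , id
    go {t = suc t} (≤′-step r≤′t) =
      proj₁ (graph-suc-mono β t) ∘ proj₁ (go r≤′t) , proj₂ (graph-suc-mono β t) ∘ proj₂ (go r≤′t)

  frozen : Partition n → ℕ → Partition n
  frozen β t = vertexPartition (graph β t)

  oracle-frozen : ∀ β t a b → oracle (frozen β t) a b ≡ same (graph β t) a b
  oracle-frozen β t = oracle-vertexPartition (graph-isAggregated β t)

  answer-remembered : ∀ β {r t} → completeᵇ (graph β r) ≡ false → r < t →
                      same (graph β t) (qu β r) (qv β r) ≡ oracle β (qu β r) (qv β r)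
  answer-remembered β {r} {t} e r<t with oracle β (qu β r) (qv β r) in o
  ... | true  = proj₁ (graph-mono β r<t) (graph-suc-same-query β r e o)
  ... | false = IsAggregated.adj⇒¬same (graph-isAggregated β t)
                  (proj₂ (graph-mono β r<t) (graph-suc-adj-query β r e o))

  run-frozen : ∀ β t r → r ≤ t → run (strategy A) (frozen β t) r ≡ run (strategy A) β r
  run-frozen β t zero    _   = refl
  run-frozen β t (suc r) r<t =
    trans (cong (runStep (strategy A) (frozen β t)) (run-frozen β t r (<⇒≤ r<t)))
          (runStep-cong (strategy A) (frozen β t) β (run (strategy A) β r)
            (λ e → trans (oracle-frozen β t _ _) (answer-remembered β e r<t)))

  graph-frozen : ∀ β t → graph (frozen β t) t ≡ graph β t
  graph-frozen β t = cong proj₂ (run-frozen β t t ≤-refl)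

  query-frozen : ∀ β t → queryAt (strategy A) (frozen β t) t ≡ queryAt (strategy A) β t
  query-frozen β t = cong (strategy A ∘ proj₁) (run-frozen β t t ≤-refl)

  frozen-same : ∀ β t s → t ≤′ s → ∀ a b → same (graph (frozen β t) s) a b ≡ same (graph β t) a b
  frozen-suc-addEdge : ∀ β t s → t ≤′ s → completeᵇ (graph (frozen β t) s) ≡ false →
                       graph (frozen β t) (suc s) ≡
                       addEdge (graph (frozen β t) s) (qu (frozen β t) s) (qv (frozen β t) s)
  frozen-same β t s ≤′-refl a b = cong (λ H → same H a b) (graph-frozen β t)
  frozen-same β t (suc s) (≤′-step t≤′s) a b = trans step-same (frozen-same β t s t≤′s a b)
    where
    γ = frozen β t
    step-same : same (graph γ (suc s)) a b ≡ same (graph γ s) a b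
    step-same = bool-cases (completeᵇ (graph γ s))
      (λ e → cong (λ H → same H a b) (graph-suc-complete γ s e))
      (λ e → cong (λ H → same H a b) (frozen-suc-addEdge β t s t≤′s e))
  frozen-suc-addEdge β t s t≤′s e = graph-suc-addEdge (frozen β t) s e
    (trans (oracle-frozen β t _ _) (trans (sym (frozen-same β t s t≤′s _ _)) (query-distinct (frozen β t) s e)))

  graph-frozen-suc : ∀ β t → completeᵇ (graph β t) ≡ false →
                     graph (frozen β t) (suc t) ≡ addEdge (graph β t) (qu β t) (qv β t)
  graph-frozen-suc β t full =
    trans (frozen-suc-addEdge β t t ≤′-refl (trans (cong completeᵇ (graph-frozen β t)) full))
          (cong₂ (λ G q → addEdge G (proj₁ q) (proj₂ q)) (graph-frozen β t) (query-frozen β t))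

G₀-squareFree : ∀ {n} → SquareFree (G₀ {n})
G₀-squareFree S with Square.a∼b S
... | ()

module Conditions {n} (A : ACAlgorithm n) where
  open Run A

  frozen-step : ∀ β t s {m f} → t ≤′ s → completeᵇ (graph (frozen β t) s) ≡ false →
                Hole (graph (frozen β t) s) m f → 4 ≤ m →
                HasHole (graph (frozen β t) (suc s)) ×
                nonAdjacentPairs (graph (frozen β t) (suc s)) < nonAdjacentPairs (graph (frozen β t) s)
  frozen-step β t s t≤′s full H 4≤m rewrite frozen-suc-addEdge β t s t≤′s full =
      Holes.addEdge-long-hole agg H 4≤m x≉y x≁y
    , nonAdjacentPairs-< {G = G} {addEdge G x y} (addEdge-keeps-adj G x y) x≁y
        (addEdge-adj-xy G x y (same-refl x) (same-refl y))
    where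
    G = graph (frozen β t) s
    x = qu (frozen β t) s
    y = qv (frozen β t) s
    agg = graph-isAggregated (frozen β t) s
    open IsAggregated agg
    x≉y = query-distinct (frozen β t) s full
    x≁y = query-nonadj (frozen β t) s full

  frozen-run-reaches-C4 : ∀ β t s {m f} → t ≤′ s → Hole (graph (frozen β t) s) m f →
                          Σ ℕ λ s′ → HasInducedC4 (graph (frozen β t) s′)
  frozen-run-reaches-C4 β t s t≤′s H = go s t≤′s H (<-wellFounded _)
    where
    γ = frozen β t
    go : ∀ s {m f} → t ≤′ s → Hole (graph γ s) m f → Acc _<_ (nonAdjacentPairs (graph γ s)) →
         Σ ℕ λ s′ → HasInducedC4 (graph γ s′)
    go s {m} {f} t≤′s H (acc smaller) with m ≟ℕ 3 | completeᵇ (graph γ s) in full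
    ... | yes refl | _     = s , _ , InducedCycles.hole⇒inducedCycle (graph-isAggregated γ s) H
    ... | no _     | true  = ⊥-elim (complete-no-hole full (m , f , H))
    ... | no m≢3   | false with frozen-step β t s t≤′s full H (≤∧≢⇒< (Hole.size H) (m≢3 ∘ sym))
    ...   | (_ , _ , H′) , progress = go (suc s) (≤′-step t≤′s) H′ (smaller progress)

  noC4⇒no-hole : CondNoC4 A → ∀ β t → ¬ HasHole (graph β t)
  noC4⇒no-hole noC4 β t (m , f , H) with frozen-run-reaches-C4 β t t ≤′-refl
                                            (subst (λ G → Hole G m f) (sym (graph-frozen β t)) H)
  ... | s , C4 = noC4 (frozen β t) s C4

  chordal⇒noC4 : CondChordal A → CondNoC4 A
  chordal⇒noC4 chordal β t (c , C) with chordal β t 4 c C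
  ... | ()

  noC4⇒chordal : CondNoC4 A → CondChordal A
  noC4⇒chordal noC4 β t (suc m) c C with suc m ≟ℕ 3
  ... | yes 1+m≡3 = 1+m≡3
  ... | no  1+m≢3 = ⊥-elim (noC4⇒no-hole noC4 β t (m , c ∘ toFin m ,
          InducedCycles.inducedCycle⇒hole (graph-isAggregated β t) C
            (s≤s⁻¹ (≤∧≢⇒< (InducedCycle.length≥3 C) (1+m≢3 ∘ sym)))))

  noC4⇒separation : CondNoC4 A → CondSeparation A
  noC4⇒separation noC4 β t incomplete =
    (λ { (u∼u , _) → adj-irrefl u∼u (same-refl _) }) ,
    (λ { (_ , v∼v) → adj-irrefl v∼v (same-refl _) }) ,
    λ W → noC4⇒no-hole noC4 (frozen β t) (suc t)
            (subst HasHole (sym (graph-frozen-suc β t full))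
              (PathHoles.walk⇒hole agg (query-distinct β t full) (query-nonadj β t full) W))
    where
    agg = graph-isAggregated β t
    open IsAggregated agg
    full = ¬-not incomplete

  separation⇒squareFree : CondSeparation A → ∀ β t → SquareFree (graph β t)
  separation⇒squareFree separated β zero = G₀-squareFree
  separation⇒squareFree separated β (suc t)
    with completeᵇ (graph β t) in full | oracle β (qu β t) (qv β t)
  ... | true  | _      = separation⇒squareFree separated β t
  ... | false | answer = next-squareFree answer
    where
    open SeparatedQuery (graph-isAggregated β t) (query-distinct β t full) (query-nonadj β t full)
                        (separated β t (not-¬ full)) (separation⇒squareFree separated β t)
    next-squareFree : ∀ b → SquareFree (if b then merge (graph β t) (qu β t) (qv β t)
                                         else addEdge (graph β t) (qu β t) (qv β t))
    next-squareFree true  = merge-squareFree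
    next-squareFree false = addEdge-squareFree

  separation⇒noC4 : CondSeparation A → CondNoC4 A
  separation⇒noC4 separated β t C4 with Squares.inducedC4⇒square (graph-isAggregated β t) C4
  ... | _ , S = separation⇒squareFree separated β t S

lemma6 : ∀ {n : ℕ} (A : ACAlgorithm n) →
         (CondChordal A ⇔ CondNoC4 A) × (CondNoC4 A ⇔ CondSeparation A)
lemma6 A = mk⇔ chordal⇒noC4 noC4⇒chordal , mk⇔ noC4⇒separation separation⇒noC4
  where open Conditions A
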